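{- Let $n\ge1$ and let $F$ be a facet of Simion's type $B$ associahedron $\Gamma_n^B$. Then $F$ contains exactly one diameter; let it be $\{k,\overline{k}\}$ ($1\le k\le n+1$), so that the arrow representation of $F$ contains $(k-1,k)$ if $k\ge2$, resp. $(n+1,1)$ if $k=1$. Then the simplex spanned by the arrows representing the elements of $F$ is contained in $\zeta^{k-1}(P_n^+)$. Equivalently, this simplex is contained in $\zeta^{k-1}(P_n^+)$ exactly when $F$ contains the diameter $\{k,\overline{k}\}$.
   Context: Label the vertices of a regular $(2n+2)$-gon clockwise by $1,\ldots,n+1,\overline{1},\ldots,\overline{n+1}$. A $B$-diagonal is either a diameter $\{i,\overline{i}\}$ ($1\le i\le n+1$), or an antipodal pair of diagonals $\{\{i,j\},\{\overline{i},\overline{j}\}\}$ with $1\le i<i+1<j\le n+1$, or $\{\{i,\overline{j}\},\{\overline{i},j\}\}$ with $1\le j<i\le n+1$. Two $B$-diagonals cross if a diagonal of one and a diagonal of the other meet in the interior of the polygon. $\Gamma_n^B$ is the simplicial complex on the $B$-diagonals whose faces are the pairwise noncrossing sets; a facet is a maximal face. The Legendre polytope $P_n\subset\mathbb{R}^{n+1}$ is the convex hull of all $e_j-e_i$, $i\ne j$; the vertex $e_j-e_i$ is written $(i,j)$ (an arrow). The arrow representation maps $B$-diagonals to arrows: $\{i,\overline{i}\}\mapsto(i-1,i)$ for $2\le i\le n+1$, $\{1,\overline{1}\}\mapsto(n+1,1)$; $\{\{i,j\},\{\overline{i},\overline{j}\}\}\mapsto(j-1,i)$ for $1\le i<i+1<j\le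 n+1$; $\{\{i,\overline{j}\},\{\overline{i},j\}\}\mapsto(j-1,i)$ for $2\le j<i\le n+1$; $\{\{1,\overline{i}\},\{\overline{1},i\}\}\mapsto(n+1,i)$ for $2\le i\le n+1$. $P_n^+$ is the convex hull of the origin and all points $e_i-e_j$ with $1\le i<j\le n+1$. The permutation $\zeta=(1,2,\ldots,n+1)$ acts linearly on $\mathbb{R}^{n+1}$ by $e_i\mapsto e_{\zeta(i)}$.
   Formalization: Points are taken in ℚ^(n+1) rather than ℝ^(n+1), so the simplex spanned by the arrows and $\zeta^{k-1}(P_n^+)$ are formed with rational convex combinations. -}

module Defs where

open import Data.Nat using (ℕ; zero; suc; _+_; _∸_; _≤_; _<_; _≡ᵇ_)
open import Data.Fin using (Fin; toℕ; inject₁; fromℕ)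
import Data.Fin as Fin
open import Data.Rational using (ℚ; 0ℚ; 1ℚ) renaming (_+_ to _+ℚ_; _*_ to _*ℚ_; _-_ to _-ℚ_; _≤_ to _≤ℚ_)
open import Data.List using (List; []; _∷_; foldr; zipWith; length)
open import Data.List.Relation.Unary.All using (All)
open import Data.List.Relation.Unary.Any using (Any)
open import Data.List.Membership.Propositional using (_∈_; _∉_)
open import Data.Product using (Σ; _×_; ∃; ∃-syntax)
open import Data.Sum using (_⊎_)
open import Data.Bool using (if_then_else_)
open import Data.Empty using (⊥)
open import Relation.Nullary using (¬_)
open import Relation.Binary.PropositionalEquality using (_≡_)

-- B-diagonals of the regular (2n+2)-gon, vertices 1..n+1, 1̄..(n+1)̄.

data BDiag (n : ℕ) : Set where
  -- diameter {i, ī}, 1 ≤ i ≤ n+1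
  diam  : (i : ℕ) → 1 ≤ i → i ≤ suc n → BDiag n
  -- {{i,j},{ī,j̄}}, 1 ≤ i < i+1 < j ≤ n+1
  same  : (i j : ℕ) → 1 ≤ i → suc i < j → j ≤ suc n → BDiag n
  -- {{i,j̄},{ī,j}}, 1 ≤ j < i ≤ n+1
  mixed : (i j : ℕ) → 1 ≤ j → j < i → i ≤ suc n → BDiag n

-- Positions on the polygon, clockwise 0..2n+1:
-- vertex i (1 ≤ i ≤ n+1) sits at i-1, vertex ī at n+i.
pos : ℕ → ℕ → ℕ
pos n i = i ∸ 1

posBar : ℕ → ℕ → ℕ
posBar n i = n + i

record Seg : Set where
  constructor seg
  field
    end₁ end₂ : ℕ

segs : ∀ {n} → BDiag n → List Seg
segs {n} (diam i _ _)      = seg (pos n i) (posBar n i) ∷ []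
segs {n} (same i j _ _ _)  = seg (pos n i) (pos n j) ∷ seg (posBar n i) (posBar n j) ∷ []
segs {n} (mixed i j _ _ _) = seg (pos n i) (posBar n j) ∷ seg (posBar n i) (pos n j) ∷ []

-- two chords of a convex polygon (with endpoints given by positions in
-- cyclic order) meet in the interior iff their endpoints strictly interleave
Interleave : ℕ → ℕ → ℕ → ℕ → Set
Interleave a b c d = (a < c × c < b × b < d) ⊎ (c < a × a < d × d < b)

SegCross : Seg → Seg → Set
SegCross (seg a b) (seg c d) =
  Interleave a b c d ⊎ Interleave b a c d ⊎ Interleave a b d c ⊎ Interleave b a d c

Cross : ∀ {n} → BDiag n → BDiag n → Set
Cross x y = Any (λ s → Any (λ t → SegCross s t) (segs y)) (segs x)

IsFace : ∀ {n} → List (BDiag n) → Set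
IsFace F = ∀ {x y} → x ∈ F → y ∈ F → ¬ Cross x y

IsFacet : ∀ {n} → List (BDiag n) → Set
IsFacet F = IsFace F × (∀ d → d ∉ F → ¬ IsFace (d ∷ F))

IsDiamOf : ∀ {n} → BDiag n → ℕ → Set
IsDiamOf (diam i _ _)      k = i ≡ k
IsDiamOf (same _ _ _ _ _)  k = ⊥
IsDiamOf (mixed _ _ _ _ _) k = ⊥

HasDiam : ∀ {n} → List (BDiag n) → ℕ → Set
HasDiam F k = Any (λ d → IsDiamOf d k) F

-- Vectors in ℚ^{n+1}; coordinate t : Fin (n+1) is coordinate number toℕ t + 1.

Vec : ℕ → Set
Vec n = Fin (suc n) → ℚ

_≗ᵥ_ : ∀ {n} → Vec n → Vec n → Set
x ≗ᵥ y = ∀ t → x t ≡ y t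

zeroV : ∀ {n} → Vec n
zeroV t = 0ℚ

e : ∀ {n} → ℕ → Vec n
e j t = if (suc (toℕ t) ≡ᵇ j) then 1ℚ else 0ℚ

_-ᵥ_ : ∀ {n} → Vec n → Vec n → Vec n
(x -ᵥ y) t = x t -ℚ y t

sumℚ : List ℚ → ℚ
sumℚ = foldr _+ℚ_ 0ℚ

ConvComb : ∀ {n} → List (Vec n) → Vec n → Set
ConvComb ps x =
  Σ (List ℚ) λ ws →
    length ws ≡ length ps × All (0ℚ ≤ℚ_) ws × sumℚ ws ≡ 1ℚ ×
    (∀ t → x t ≡ sumℚ (zipWith (λ w p → w *ℚ p t) ws ps))

Conv : ∀ {n} → (Vec n → Set) → Vec n → Set
Conv S x = Σ (List _) λ ps → All S ps × ConvComb ps x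

arrowVec : ∀ {n} → ℕ → ℕ → Vec n
arrowVec i j = e j -ᵥ e i

arrowOf : ∀ {n} → BDiag n → ℕ × ℕ
arrowOf {n} (diam 1 _ _)              = Data.Product._,_ (suc n) 1
arrowOf {n} (diam i _ _)              = Data.Product._,_ (i ∸ 1) i
arrowOf {n} (same i j _ _ _)          = Data.Product._,_ (j ∸ 1) i
arrowOf {n} (mixed i 1 _ _ _)         = Data.Product._,_ (suc n) i
arrowOf {n} (mixed i j _ _ _)         = Data.Product._,_ (j ∸ 1) i

arrowVecOf : ∀ {n} → BDiag n → Vec n
arrowVecOf d = arrowVec (Data.Product.proj₁ (arrowOf d)) (Data.Product.proj₂ (arrowOf d))

ArrowSimplex : ∀ {n} → List (BDiag n) → Vec n → Set
ArrowSimplex F = Conv (λ v → ∃[ d ] (d ∈ F × v ≗ᵥ arrowVecOf d))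

PplusGen : ∀ {n} → Vec n → Set
PplusGen {n} x =
  x ≗ᵥ zeroV ⊎ (∃[ i ] ∃[ j ] (1 ≤ i × i < j × j ≤ suc n × x ≗ᵥ (e i -ᵥ e j)))

Pplus : ∀ {n} → Vec n → Set
Pplus = Conv PplusGen

predC : ∀ {n} → Fin (suc n) → Fin (suc n)
predC {n} Fin.zero = fromℕ n
predC (Fin.suc t)  = inject₁ t

-- ζ : e_i ↦ e_{ζ(i)}, ζ = (1 2 … n+1); so (ζ x)_{i+1} = x_i cyclically
ζ : ∀ {n} → Vec n → Vec n
ζ x t = x (predC t)

ζ^ : ∀ {n} → ℕ → Vec n → Vec n
ζ^ zero x    = x
ζ^ (suc m) x = ζ (ζ^ m x)

ZetaPplus : ∀ {n} → ℕ → Vec n → Set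
ZetaPplus m y = ∃[ x ] (Pplus x × y ≗ᵥ ζ^ m x)

_⊆ᵥ_ : ∀ {n} → (Vec n → Set) → (Vec n → Set) → Set
A ⊆ᵥ B = ∀ y → A y → B y

-- A facet F contains a diameter: otherwise take j maximal among the mixed B-diagonals
-- {{i, j̄}, {ī, j}} of F (j = 1 if there is none); the diameter {j, j̄} crosses no element of F,
-- contradicting maximality. Two distinct diameters cross, so the diameter is unique.
--
-- Since ζ permutes coordinates, y ∈ ζ^k(P⁺) iff ζ^{−k} y lies in P⁺, the convex hull of 0 and the
-- e_i − e_j with i < j. If {k+1, k̄+1} ∈ F, no element of F crosses this diameter, and a case analysis
-- shows that every arrow (a, b) of F has its head b before its tail a in the cyclic order
-- k+1, …, n+1, 1, …, k (or a = b), so that ζ^{−k}(e_b − e_a) is one of these generators.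
-- Conversely, if the diameter of F is {b, b̄} with b ≠ k+1, its relabelled arrow is e_{c+1} − e_c
-- for some c, on which the functional x₁ + ⋯ + x_c, nonnegative on P⁺, takes the value −1.

module Submission where

open import Defs
open import Data.Nat using (ℕ; zero; suc; _+_; _∸_; _≤_; _<_; _≡ᵇ_; z≤n; s≤s; _⊔_)
open import Data.Nat.Properties
open import Data.Fin using (Fin; toℕ; inject₁; fromℕ)
import Data.Fin as Fin
open import Data.Bool using (true; false; if_then_else_; T)
open import Data.Unit using (tt; ⊤)
open import Data.Empty using (⊥; ⊥-elim)
open import Data.Product using (Σ; _×_; _,_; proj₁; proj₂; ∃-syntax)
open import Data.Sum using (_⊎_; inj₁; inj₂; [_,_]′; map₂) renaming (map to map⊎)
open import Relation.Nullary using (¬_; Dec; yes; no)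
open import Relation.Nullary.Decidable using (toWitness; toWitnessFalse)
open import Relation.Binary.PropositionalEquality
open import Relation.Binary using (tri<; tri≈; tri>)
open import Data.List using (List; []; _∷_; zipWith; map)
open import Data.List.Properties using (length-map)
open import Data.List.Relation.Unary.All using (All; []; _∷_)
import Data.List.Relation.Unary.All as All
import Data.List.Relation.Unary.All.Properties as AllP
open import Data.List.Relation.Unary.Any using (here; there)
import Data.List.Relation.Unary.Any as Any
import Data.List.Relation.Unary.Any.Properties as AnyP
open import Data.List.Membership.Propositional using (_∈_)
open import Data.Rational using (ℚ; 0ℚ; 1ℚ) renaming (_+_ to _+ℚ_; _*_ to _*ℚ_; _-_ to _-ℚ_; _≤_ to _≤ℚ_)
import Data.Rational as ℚ
import Data.Rational.Properties as ℚP
open import Data.Rational.Solver using (module +-*-Solver)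
open +-*-Solver using (solve; _:+_; _:-_; _:=_)

sucOrWrap : ∀ {n} → Fin (suc n) → Fin (suc (suc n))
sucOrWrap Fin.zero    = Fin.zero
sucOrWrap (Fin.suc u) = Fin.suc (Fin.suc u)

sucC : ∀ {n} → Fin (suc n) → Fin (suc n)
sucC {zero}  Fin.zero    = Fin.zero
sucC {suc n} Fin.zero    = Fin.suc Fin.zero
sucC {suc n} (Fin.suc t) = sucOrWrap (sucC t)

sucC-fromℕ : ∀ n → sucC (fromℕ n) ≡ Fin.zero
sucC-fromℕ zero = refl
sucC-fromℕ (suc n) rewrite sucC-fromℕ n = refl

sucC-inject₁ : ∀ {n} (u : Fin (suc n)) → sucC (inject₁ u) ≡ Fin.suc u
sucC-inject₁ {zero}  Fin.zero    = refl
sucC-inject₁ {suc n} Fin.zero    = refl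
sucC-inject₁ {suc n} (Fin.suc u) rewrite sucC-inject₁ u = refl

sucC-predC : ∀ {n} (t : Fin (suc n)) → sucC (predC t) ≡ t
sucC-predC {n}     Fin.zero    = sucC-fromℕ n
sucC-predC {suc n} (Fin.suc u) = sucC-inject₁ u

predC-sucC : ∀ {n} (t : Fin (suc n)) → predC (sucC t) ≡ t
predC-sucC {zero}  Fin.zero    = refl
predC-sucC {suc n} Fin.zero    = refl
predC-sucC {suc n} (Fin.suc u) with sucC u | predC-sucC u
... | Fin.zero  | ih = cong Fin.suc ih
... | Fin.suc v | ih = cong Fin.suc ih

toℕ-sucC : ∀ {n} (s : Fin (suc n)) →
  (toℕ s ≡ n × sucC s ≡ Fin.zero) ⊎ (toℕ s ≢ n × toℕ (sucC s) ≡ suc (toℕ s))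
toℕ-sucC {zero}  Fin.zero    = inj₁ (refl , refl)
toℕ-sucC {suc n} Fin.zero    = inj₂ ((λ ()) , refl)
toℕ-sucC {suc n} (Fin.suc u) with toℕ-sucC u
... | inj₁ (u≡n , wrap) rewrite wrap = inj₁ (cong suc u≡n , refl)
... | inj₂ (u≢n , step) = inj₂ ((λ r → u≢n (suc-injective r)) , toℕ-sucOrWrap (sucC u) step)
  where
  toℕ-sucOrWrap : (w : Fin (suc n)) → toℕ w ≡ suc (toℕ u) → toℕ (sucOrWrap w) ≡ suc (suc (toℕ u))
  toℕ-sucOrWrap (Fin.suc v) r = cong suc r

sucC^ : ∀ {n} → ℕ → Fin (suc n) → Fin (suc n)
sucC^ zero    s = s
sucC^ (suc m) s = sucC (sucC^ m s)

-- `e` for vectors of any length (`e {n} j` is `basis {suc n} j`), so that prefix sums can recurse on the length.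
basis : ∀ {m} → ℕ → Fin m → ℚ
basis j t = if (suc (toℕ t) ≡ᵇ j) then 1ℚ else 0ℚ

basis-cases : ∀ {m} j (t : Fin m) →
  (suc (toℕ t) ≡ j × basis j t ≡ 1ℚ) ⊎ (suc (toℕ t) ≢ j × basis j t ≡ 0ℚ)
basis-cases j t with suc (toℕ t) ≡ᵇ j in eq
... | true  = inj₁ (≡ᵇ⇒≡ _ _ (subst T (sym eq) tt) , refl)
... | false = inj₂ ((λ p → subst T eq (≡⇒≡ᵇ _ _ p)) , refl)

basis-≡ : ∀ {m m′} j j′ (t : Fin m) (t′ : Fin m′) →
  (suc (toℕ t) ≡ j → suc (toℕ t′) ≡ j′) → (suc (toℕ t′) ≡ j′ → suc (toℕ t) ≡ j) → basis j t ≡ basis j′ t′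
basis-≡ j j′ t t′ f g with basis-cases j t | basis-cases j′ t′
... | inj₁ (_ , p) | inj₁ (_ , q) = trans p (sym q)
... | inj₁ (a , _) | inj₂ (b , _) = ⊥-elim (b (f a))
... | inj₂ (a , _) | inj₁ (b , _) = ⊥-elim (a (g b))
... | inj₂ (_ , p) | inj₂ (_ , q) = trans p (sym q)

-- cyclic predecessor on the indices 1, …, n+1 (the value at 0 is junk)
cycPred : ℕ → ℕ → ℕ
cycPred n zero          = zero
cycPred n (suc zero)    = suc n
cycPred n (suc (suc c)) = suc c

cycPred^ : ℕ → ℕ → ℕ → ℕ
cycPred^ n zero    b = b
cycPred^ n (suc m) b = cycPred^ n m (cycPred n b)

cycPred-bounded : ∀ n b → 1 ≤ b → b ≤ suc n → 1 ≤ cycPred n b × cycPred n b ≤ suc n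
cycPred-bounded n (suc zero)    _ _        = s≤s z≤n , ≤-refl
cycPred-bounded n (suc (suc c)) _ (s≤s le) = s≤s z≤n , m≤n⇒m≤1+n le

basis-sucC : ∀ {n} b → 1 ≤ b → b ≤ suc n → (s : Fin (suc n)) → basis b (sucC s) ≡ basis (cycPred n b) s
basis-sucC {n} (suc zero) _ _ s with toℕ-sucC s
... | inj₁ (s≡n , wrap) rewrite wrap = basis-≡ 1 (suc n) (Fin.zero {suc n}) s (λ _ → cong suc s≡n) (λ _ → refl)
... | inj₂ (s≢n , step) = basis-≡ 1 (suc n) (sucC s) s (λ r → ⊥-elim (noWrap r)) (λ r → ⊥-elim (s≢n (suc-injective r)))
  where
  noWrap : suc (toℕ (sucC s)) ≢ 1
  noWrap r = 1+n≢0 (suc-injective (trans (sym (cong suc step)) r))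
basis-sucC {n} (suc (suc c)) _ (s≤s c<n) s with toℕ-sucC s
... | inj₁ (s≡n , wrap) rewrite wrap = basis-≡ (suc (suc c)) (suc c) (Fin.zero {suc n}) s (λ ()) (λ r → ⊥-elim (s≢c r))
  where
  s≢c : suc (toℕ s) ≢ suc c
  s≢c r = <-irrefl (trans (sym (suc-injective r)) s≡n) c<n
... | inj₂ (_ , step) = basis-≡ (suc (suc c)) (suc c) (sucC s) s
  (λ r → suc-injective (trans (sym (cong suc step)) r)) (λ r → trans (cong suc step) (cong suc r))

basis-sucC^ : ∀ {n} m b → 1 ≤ b → b ≤ suc n → (s : Fin (suc n)) → basis b (sucC^ m s) ≡ basis (cycPred^ n m b) s
basis-sucC^ zero b _ _ s = refl
basis-sucC^ {n} (suc m) b 1≤b b≤n s =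
  trans (basis-sucC b 1≤b b≤n (sucC^ m s))
        (basis-sucC^ m (cycPred n b) (proj₁ (cycPred-bounded n b 1≤b b≤n)) (proj₂ (cycPred-bounded n b 1≤b b≤n)) s)

-- r is b shifted cyclically down by m within 1, …, n+1
CycShift : ℕ → ℕ → ℕ → ℕ → Set
CycShift n m b r = (m < b × r + m ≡ b) ⊎ (b ≤ m × r + m ≡ b + suc n)

cycPred^-shift : ∀ n m b → m ≤ n → 1 ≤ b → b ≤ suc n → CycShift n m b (cycPred^ n m b)
cycPred^-shift n zero b _ 1≤b _ = inj₁ (1≤b , +-identityʳ b)
cycPred^-shift n (suc m) (suc zero) m<n _ _ with cycPred^-shift n m (suc n) (<⇒≤ m<n) (s≤s z≤n) ≤-refl
... | inj₁ (_ , eq)   = inj₂ (s≤s z≤n , trans (+-suc _ m) (cong suc eq))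
... | inj₂ (n<m , _)  = ⊥-elim (<⇒≱ m<n (<⇒≤ n<m))
cycPred^-shift n (suc m) (suc (suc c)) m<n _ (s≤s c<n) with cycPred^-shift n m (suc c) (<⇒≤ m<n) (s≤s z≤n) (m≤n⇒m≤1+n c<n)
... | inj₁ (m<c , eq) = inj₁ (s≤s m<c , trans (+-suc _ m) (cong suc eq))
... | inj₂ (c≤m , eq) = inj₂ (s≤s c≤m , trans (+-suc _ m) (cong suc eq))

CycShift-noWrap : ∀ {n m b r} → CycShift n m b r → m < b → r + m ≡ b
CycShift-noWrap (inj₁ (_ , eq)) _      = eq
CycShift-noWrap (inj₂ (b≤m , _)) m<b = ⊥-elim (<⇒≱ m<b b≤m)

CycShift-wrap : ∀ {n m b r} → CycShift n m b r → b ≤ m → r + m ≡ b + suc n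
CycShift-wrap (inj₁ (m<b , _)) b≤m = ⊥-elim (<⇒≱ m<b b≤m)
CycShift-wrap (inj₂ (_ , eq)) _    = eq

m<r+m⇒r>0 : ∀ {m r} → m < r + m → 1 ≤ r
m<r+m⇒r>0 {r = zero}  m<m = ⊥-elim (<-irrefl refl m<m)
m<r+m⇒r>0 {r = suc r} _   = s≤s z≤n

CycShift-bounded : ∀ {n m b r} → m ≤ n → b ≤ suc n → CycShift n m b r → 1 ≤ r × r ≤ suc n
CycShift-bounded {n} {m} {b} {r} _ b≤n (inj₁ (m<b , eq)) =
  m<r+m⇒r>0 (subst (m <_) (sym eq) m<b) , ≤-trans (m≤m+n r m) (subst (_≤ suc n) (sym eq) b≤n)
CycShift-bounded {n} {m} {b} {r} m≤n _ (inj₂ (b≤m , eq)) =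
  m<r+m⇒r>0 (subst (m <_) (sym eq) (≤-<-trans m≤n (m≤n+m (suc n) b))) ,
  +-cancelʳ-≤ m r (suc n) (subst (_≤ suc n + m) (sym eq)
    (≤-trans (+-monoˡ-≤ (suc n) b≤m) (≤-reflexive (+-comm m (suc n)))))

cycPred^-bounded : ∀ {n} m b → m ≤ n → 1 ≤ b → b ≤ suc n → 1 ≤ cycPred^ n m b × cycPred^ n m b ≤ suc n
cycPred^-bounded {n} m b m≤n 1≤b b≤n = CycShift-bounded m≤n b≤n (cycPred^-shift n m b m≤n 1≤b b≤n)

-- b comes strictly before a in the cyclic order m+1, …, n+1, 1, …, m
CyclicallyBefore : ℕ → ℕ → ℕ → Set
CyclicallyBefore m b a = (m < b × m < a × b < a) ⊎ (m < b × a ≤ m) ⊎ (b ≤ m × a ≤ m × b < a)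

cycPred^-< : ∀ {n} m a b → m ≤ n → 1 ≤ a → a ≤ suc n → 1 ≤ b → b ≤ suc n →
  CyclicallyBefore m b a → cycPred^ n m b < cycPred^ n m a
cycPred^-< {n} m a b m≤n 1≤a a≤n 1≤b b≤n before = +-cancelʳ-< m rb ra (shifted before)
  where
  rb = cycPred^ n m b
  ra = cycPred^ n m a
  sb = cycPred^-shift n m b m≤n 1≤b b≤n
  sa = cycPred^-shift n m a m≤n 1≤a a≤n
  shifted : CyclicallyBefore m b a → rb + m < ra + m
  shifted (inj₁ (m<b , m<a , b<a)) =
    subst₂ _<_ (sym (CycShift-noWrap sb m<b)) (sym (CycShift-noWrap sa m<a)) b<a
  shifted (inj₂ (inj₁ (m<b , a≤m))) =
    subst₂ _<_ (sym (CycShift-noWrap sb m<b)) (sym (CycShift-wrap sa a≤m)) (≤-<-trans b≤n (+-monoˡ-≤ (suc n) 1≤a))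
  shifted (inj₂ (inj₂ (b≤m , a≤m , b<a))) =
    subst₂ _<_ (sym (CycShift-wrap sb b≤m)) (sym (CycShift-wrap sa a≤m)) (+-monoˡ-< (suc n) b<a)

arrow∘sucC^-PplusGen : ∀ {n} m a b → m ≤ n → 1 ≤ a → a ≤ suc n → 1 ≤ b → b ≤ suc n →
  a ≡ b ⊎ CyclicallyBefore m b a → PplusGen {n} (λ s → arrowVec a b (sucC^ m s))
arrow∘sucC^-PplusGen m a b _ _ _ _ _ (inj₁ refl) = inj₁ (λ s → ℚP.+-inverseʳ (e b (sucC^ m s)))
arrow∘sucC^-PplusGen {n} m a b m≤n 1≤a a≤n 1≤b b≤n (inj₂ before) =
  inj₂ (cycPred^ n m b , cycPred^ n m a ,
        proj₁ (cycPred^-bounded m b m≤n 1≤b b≤n) ,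
        cycPred^-< m a b m≤n 1≤a a≤n 1≤b b≤n before ,
        proj₂ (cycPred^-bounded m a m≤n 1≤a a≤n) ,
        λ s → cong₂ _-ℚ_ (basis-sucC^ m b 1≤b b≤n s) (basis-sucC^ m a 1≤a a≤n s))

Conv-resp : ∀ {n} {S : Vec n → Set} {x y : Vec n} → x ≗ᵥ y → Conv S x → Conv S y
Conv-resp x≗y (ps , inS , ws , len , nonneg , total , x≡) =
  ps , inS , ws , len , nonneg , total , λ t → trans (sym (x≗y t)) (x≡ t)

ζ^-sucC^ : ∀ {n} m (x y : Vec n) → y ≗ᵥ ζ^ m x → ∀ s → x s ≡ y (sucC^ m s)
ζ^-sucC^ zero    x y y≗x s = sym (y≗x s)
ζ^-sucC^ (suc m) x y y≗ζx s = ζ^-sucC^ m x (λ t → y (sucC t)) y∘sucC≗ s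
  where
  y∘sucC≗ : (λ t → y (sucC t)) ≗ᵥ ζ^ m x
  y∘sucC≗ t = trans (y≗ζx (sucC t)) (cong (ζ^ m x) (predC-sucC t))

ZetaPplus-intro : ∀ {n} m (y : Vec n) → Pplus (λ s → y (sucC^ m s)) → ZetaPplus m y
ZetaPplus-intro zero    y p = y , p , λ t → refl
ZetaPplus-intro (suc m) y p with ZetaPplus-intro m (λ t → y (sucC t)) p
... | x , px , y∘sucC≗ = x , px , λ t → trans (cong y (sym (sucC-predC t))) (y∘sucC≗ (predC t))

ZetaPplus-elim : ∀ {n} m (y : Vec n) → ZetaPplus m y → Pplus (λ s → y (sucC^ m s))
ZetaPplus-elim m y (x , px , y≗ζx) = Conv-resp (ζ^-sucC^ m x y y≗ζx) px

prefixSum : ∀ {m} → ℕ → (Fin m → ℚ) → ℚ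
prefixSum zero    v = 0ℚ
prefixSum {zero}  (suc c) v = 0ℚ
prefixSum {suc m} (suc c) v = v Fin.zero +ℚ prefixSum c (λ t → v (Fin.suc t))

prefixSum-cong : ∀ {m} c {f g : Fin m → ℚ} → (∀ t → f t ≡ g t) → prefixSum c f ≡ prefixSum c g
prefixSum-cong zero    f≗g = refl
prefixSum-cong {zero}  (suc c) f≗g = refl
prefixSum-cong {suc m} (suc c) f≗g = cong₂ _+ℚ_ (f≗g Fin.zero) (prefixSum-cong c (λ t → f≗g (Fin.suc t)))

prefixSum-zero : ∀ {m} c → prefixSum {m} c (λ _ → 0ℚ) ≡ 0ℚ
prefixSum-zero zero = refl
prefixSum-zero {zero}  (suc c) = refl
prefixSum-zero {suc m} (suc c) = trans (cong (0ℚ +ℚ_) (prefixSum-zero c)) (ℚP.+-identityˡ 0ℚ)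

prefixSum-add : ∀ {m} c (f g : Fin m → ℚ) → prefixSum c (λ t → f t +ℚ g t) ≡ prefixSum c f +ℚ prefixSum c g
prefixSum-add zero    f g = sym (ℚP.+-identityˡ 0ℚ)
prefixSum-add {zero}  (suc c) f g = sym (ℚP.+-identityˡ 0ℚ)
prefixSum-add {suc m} (suc c) f g =
  trans (cong ((f Fin.zero +ℚ g Fin.zero) +ℚ_) (prefixSum-add c _ _))
        (solve 4 (λ a b x y → (a :+ b) :+ (x :+ y) := (a :+ x) :+ (b :+ y)) refl
           (f Fin.zero) (g Fin.zero) (prefixSum c (λ t → f (Fin.suc t))) (prefixSum c (λ t → g (Fin.suc t))))

prefixSum-sub : ∀ {m} c (f g : Fin m → ℚ) → prefixSum c (λ t → f t -ℚ g t) ≡ prefixSum c f -ℚ prefixSum c g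
prefixSum-sub zero    f g = refl
prefixSum-sub {zero}  (suc c) f g = refl
prefixSum-sub {suc m} (suc c) f g =
  trans (cong ((f Fin.zero -ℚ g Fin.zero) +ℚ_) (prefixSum-sub c _ _))
        (solve 4 (λ a b x y → (a :- b) :+ (x :- y) := (a :+ x) :- (b :+ y)) refl
           (f Fin.zero) (g Fin.zero) (prefixSum c (λ t → f (Fin.suc t))) (prefixSum c (λ t → g (Fin.suc t))))

prefixSum-scale : ∀ {m} c w (f : Fin m → ℚ) → prefixSum c (λ t → w *ℚ f t) ≡ w *ℚ prefixSum c f
prefixSum-scale zero    w f = sym (ℚP.*-zeroʳ w)
prefixSum-scale {zero}  (suc c) w f = sym (ℚP.*-zeroʳ w)
prefixSum-scale {suc m} (suc c) w f =
  trans (cong ((w *ℚ f Fin.zero) +ℚ_) (prefixSum-scale c w _))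
        (sym (ℚP.*-distribˡ-+ w (f Fin.zero) (prefixSum c (λ t → f (Fin.suc t)))))

prefixSum-basis-out : ∀ {m} c j → c < j → prefixSum {m} c (basis j) ≡ 0ℚ
prefixSum-basis-out zero    j c<j = refl
prefixSum-basis-out {zero}  (suc c) j c<j = refl
prefixSum-basis-out {suc m} (suc c) (suc (suc j)) (s≤s c<j) =
  trans (cong (0ℚ +ℚ_) (prefixSum-basis-out c (suc j) c<j)) (ℚP.+-identityˡ 0ℚ)

prefixSum-basis-in : ∀ {m} c j → 1 ≤ j → j ≤ c → j ≤ m → prefixSum {m} c (basis j) ≡ 1ℚ
prefixSum-basis-in {suc m} (suc c) (suc zero) _ _ _ =
  trans (cong (1ℚ +ℚ_) (prefixSum-zero c)) (ℚP.+-identityʳ 1ℚ)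
prefixSum-basis-in {suc m} (suc c) (suc (suc j)) _ (s≤s j≤c) (s≤s j≤m) =
  trans (cong (0ℚ +ℚ_) (prefixSum-basis-in c (suc j) (s≤s z≤n) j≤c j≤m)) (ℚP.+-identityˡ 1ℚ)

prefixSum-combination : ∀ {n} c (ws : List ℚ) (ps : List (Vec n)) →
  prefixSum c (λ t → sumℚ (zipWith (λ w p → w *ℚ p t) ws ps)) ≡ sumℚ (zipWith _*ℚ_ ws (map (prefixSum c) ps))
prefixSum-combination c []       ps       = prefixSum-zero c
prefixSum-combination c (w ∷ ws) []       = prefixSum-zero c
prefixSum-combination c (w ∷ ws) (p ∷ ps) =
  trans (prefixSum-add c (λ t → w *ℚ p t) (λ t → sumℚ (zipWith (λ w p → w *ℚ p t) ws ps)))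
        (cong₂ _+ℚ_ (prefixSum-scale c w p) (prefixSum-combination c ws ps))

nonneg-combination : (ws vs : List ℚ) → All (0ℚ ≤ℚ_) ws → All (0ℚ ≤ℚ_) vs → 0ℚ ≤ℚ sumℚ (zipWith _*ℚ_ ws vs)
nonneg-combination []       vs       _          _          = ℚP.≤-refl
nonneg-combination (w ∷ ws) []       _          _          = ℚP.≤-refl
nonneg-combination (w ∷ ws) (v ∷ vs) (0≤w ∷ 0≤ws) (0≤v ∷ 0≤vs) =
  ℚP.+-mono-≤ {0ℚ} {w *ℚ v} {0ℚ} 0≤wv (nonneg-combination ws vs 0≤ws 0≤vs)
  where
  0≤wv : 0ℚ ≤ℚ w *ℚ v
  0≤wv = ℚP.nonNegative⁻¹ _ {{ℚP.nonNeg*nonNeg⇒nonNeg w {{ℚ.nonNegative 0≤w}} v {{ℚ.nonNegative 0≤v}}}}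

Conv-prefixSum-nonneg : ∀ {n} c {S : Vec n → Set} → (∀ {p} → S p → 0ℚ ≤ℚ prefixSum c p) →
  ∀ {x} → Conv S x → 0ℚ ≤ℚ prefixSum c x
Conv-prefixSum-nonneg c S⇒0≤ (ps , inS , ws , _ , 0≤ws , _ , x≡) =
  subst (0ℚ ≤ℚ_) (sym (trans (prefixSum-cong c x≡) (prefixSum-combination c ws ps)))
    (nonneg-combination ws (map (prefixSum c) ps) 0≤ws (AllP.map⁺ (All.map S⇒0≤ inS)))

PplusGen-prefixSum-nonneg : ∀ {n} c {p : Vec n} → PplusGen p → 0ℚ ≤ℚ prefixSum c p
PplusGen-prefixSum-nonneg c (inj₁ p≗0) = ℚP.≤-reflexive (sym (trans (prefixSum-cong c p≗0) (prefixSum-zero c)))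
PplusGen-prefixSum-nonneg {n} c (inj₂ (i , j , 1≤i , i<j , j≤n , p≗)) =
  subst (0ℚ ≤ℚ_) (sym (trans (prefixSum-cong c p≗) (prefixSum-sub c (e i) (e j)))) (byCases (j ≤? c) (i ≤? c))
  where
  byCases : Dec (j ≤ c) → Dec (i ≤ c) → 0ℚ ≤ℚ prefixSum c (e {n} i) -ℚ prefixSum c (e {n} j)
  byCases (yes j≤c) _ rewrite prefixSum-basis-in {suc n} c i 1≤i (≤-trans (<⇒≤ i<j) j≤c) (≤-trans (<⇒≤ i<j) j≤n)
                            | prefixSum-basis-in {suc n} c j (≤-trans 1≤i (<⇒≤ i<j)) j≤c j≤n = ℚP.≤-refl
  byCases (no j≰c) (yes i≤c) rewrite prefixSum-basis-in {suc n} c i 1≤i i≤c (≤-trans (<⇒≤ i<j) j≤n)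
                                   | prefixSum-basis-out {suc n} c j (≰⇒> j≰c) = toWitness {a? = 0ℚ ℚ.≤? (1ℚ -ℚ 0ℚ)} tt
  byCases (no j≰c) (no i≰c) rewrite prefixSum-basis-out {suc n} c i (≰⇒> i≰c)
                                  | prefixSum-basis-out {suc n} c j (≰⇒> j≰c) = ℚP.≤-refl

Pplus-prefixSum-nonneg : ∀ {n} c {x : Vec n} → Pplus x → 0ℚ ≤ℚ prefixSum c x
Pplus-prefixSum-nonneg c = Conv-prefixSum-nonneg c (PplusGen-prefixSum-nonneg c)

pos<posBar : ∀ {n z} a → z ≤ n → z < n + suc a
pos<posBar {n} a z≤n′ = ≤-<-trans (≤-trans z≤n′ (m≤m+n n a)) (+-monoʳ-< n (n<1+n a))

posBar≮pos : ∀ {n z} a → z ≤ n → ¬ (n + suc a < z)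
posBar≮pos a z≤n′ h = <⇒≱ (pos<posBar a z≤n′) (<⇒≤ h)

posBar-cancel-< : ∀ n {a b} → n + suc a < n + suc b → a < b
posBar-cancel-< n {a} {b} h = ≤-pred (+-cancelˡ-< n (suc a) (suc b) h)

posBar-mono-< : ∀ n {a b} → a < b → n + suc a < n + suc b
posBar-mono-< n a<b = +-monoʳ-< n (s≤s a<b)

Between : ℕ → ℕ → ℕ → Set
Between a b z = (a < z × z < b) ⊎ (b < z × z < a)

Outside : ℕ → ℕ → ℕ → Set
Outside a b z = (z < a × z < b) ⊎ (a < z × b < z)

Separates : Seg → Seg → Set
Separates (seg a b) (seg c d) = (Between a b c × Outside a b d) ⊎ (Between a b d × Outside a b c)

SegCross⇒Separates : ∀ s t → SegCross s t → Separates s t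
SegCross⇒Separates (seg a b) (seg c d) (inj₁ (inj₁ (p , q , r))) = inj₁ (inj₁ (p , q) , inj₂ (<-trans p (<-trans q r) , r))
SegCross⇒Separates (seg a b) (seg c d) (inj₁ (inj₂ (p , q , r))) = inj₂ (inj₁ (q , r) , inj₁ (p , <-trans p (<-trans q r)))
SegCross⇒Separates (seg a b) (seg c d) (inj₂ (inj₁ (inj₁ (p , q , r)))) = inj₁ (inj₂ (p , q) , inj₂ (r , <-trans p (<-trans q r)))
SegCross⇒Separates (seg a b) (seg c d) (inj₂ (inj₁ (inj₂ (p , q , r)))) = inj₂ (inj₂ (q , r) , inj₁ (<-trans p (<-trans q r) , p))
SegCross⇒Separates (seg a b) (seg c d) (inj₂ (inj₂ (inj₁ (inj₁ (p , q , r))))) = inj₂ (inj₁ (p , q) , inj₂ (<-trans p (<-trans q r) , r))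
SegCross⇒Separates (seg a b) (seg c d) (inj₂ (inj₂ (inj₁ (inj₂ (p , q , r))))) = inj₁ (inj₁ (q , r) , inj₁ (p , <-trans p (<-trans q r)))
SegCross⇒Separates (seg a b) (seg c d) (inj₂ (inj₂ (inj₂ (inj₁ (p , q , r))))) = inj₂ (inj₂ (p , q) , inj₂ (r , <-trans p (<-trans q r)))
SegCross⇒Separates (seg a b) (seg c d) (inj₂ (inj₂ (inj₂ (inj₂ (p , q , r))))) = inj₁ (inj₂ (q , r) , inj₁ (<-trans p (<-trans q r) , p))

Interleave-sym : ∀ {a b c d} → Interleave a b c d → Interleave c d a b
Interleave-sym (inj₁ x) = inj₂ x
Interleave-sym (inj₂ x) = inj₁ x

SegCross-sym : ∀ s t → SegCross s t → SegCross t s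
SegCross-sym (seg a b) (seg c d) (inj₁ x)                = inj₁ (Interleave-sym x)
SegCross-sym (seg a b) (seg c d) (inj₂ (inj₁ x))         = inj₂ (inj₂ (inj₁ (Interleave-sym x)))
SegCross-sym (seg a b) (seg c d) (inj₂ (inj₂ (inj₁ x)))  = inj₂ (inj₁ (Interleave-sym x))
SegCross-sym (seg a b) (seg c d) (inj₂ (inj₂ (inj₂ x)))  = inj₂ (inj₂ (inj₂ (Interleave-sym x)))

Cross-sym : ∀ {n} (x y : BDiag n) → Cross x y → Cross y x
Cross-sym x y c = Any.map (λ {s} → Any.map (λ {t} → SegCross-sym t s)) (AnyP.swap c)
-- Below, the vertices are suc i, suc j, suc k, …, so that i, j, k, … are their positions.

¬Cross-same-diam : ∀ {n} i j {p₁ p₂ p₃} k {q₁ q₂} → suc i < j → j ≤ n → k ≤ n → (k ≤ i ⊎ j ≤ k) →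
  ¬ Cross (same {n} (suc i) (suc j) p₁ p₂ p₃) (diam (suc k) q₁ q₂)
¬Cross-same-diam {n} i j {p₁} {p₂} {p₃} k {q₁} {q₂} 1+i<j j≤n k≤n k∉⟨i,j⟩ = noCross
  where
  i<j : i < j
  i<j = <-trans (n<1+n i) 1+i<j
  notBetween : ¬ Between i j k
  notBetween (inj₁ (i<k , k<j)) = [ <⇒≱ i<k , <⇒≱ k<j ]′ k∉⟨i,j⟩
  notBetween (inj₂ (j<k , k<i)) = <-asym i<j (<-trans j<k k<i)
  unbarred : ¬ Separates (seg i j) (seg k (n + suc k))
  unbarred (inj₁ (h , _))           = notBetween h
  unbarred (inj₂ (inj₁ (_ , h) , _)) = posBar≮pos k j≤n h
  unbarred (inj₂ (inj₂ (_ , h) , _)) = posBar≮pos k (<⇒≤ (<-≤-trans i<j j≤n)) h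
  barred : ¬ Separates (seg (n + suc i) (n + suc j)) (seg k (n + suc k))
  barred (inj₁ (inj₁ (h , _) , _))    = posBar≮pos i k≤n h
  barred (inj₁ (inj₂ (h , _) , _))    = posBar≮pos j k≤n h
  barred (inj₂ (inj₁ (h₁ , h₂) , _)) = notBetween (inj₁ (posBar-cancel-< n h₁ , posBar-cancel-< n h₂))
  barred (inj₂ (inj₂ (h₁ , h₂) , _)) = notBetween (inj₂ (posBar-cancel-< n h₁ , posBar-cancel-< n h₂))
  noCross : ¬ Cross (same {n} (suc i) (suc j) p₁ p₂ p₃) (diam (suc k) q₁ q₂)
  noCross (here (here sc))         = unbarred (SegCross⇒Separates _ _ sc)
  noCross (there (here (here sc))) = barred (SegCross⇒Separates _ _ sc)
  noCross (here (there ()))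
  noCross (there (here (there ())))
  noCross (there (there ()))

¬Cross-mixed-diam : ∀ {n} i j {p₁ p₂ p₃} k {q₁ q₂} → j < i → i ≤ n → k ≤ n → j ≤ k → k ≤ i →
  ¬ Cross (mixed {n} (suc i) (suc j) p₁ p₂ p₃) (diam (suc k) q₁ q₂)
¬Cross-mixed-diam {n} i j {p₁} {p₂} {p₃} k {q₁} {q₂} j<i i≤n k≤n j≤k k≤i = noCross
  where
  j≤n : j ≤ n
  j≤n = <⇒≤ (<-≤-trans j<i i≤n)
  first : ¬ Separates (seg i (n + suc j)) (seg k (n + suc k))
  first (inj₁ (inj₁ (h , _) , _)) = <⇒≱ h k≤i
  first (inj₁ (inj₂ (h , _) , _)) = posBar≮pos j k≤n h
  first (inj₂ (inj₁ (_ , h) , _)) = <⇒≱ (posBar-cancel-< n h) j≤k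
  first (inj₂ (inj₂ (_ , h) , _)) = posBar≮pos k i≤n h
  second : ¬ Separates (seg (n + suc i) j) (seg k (n + suc k))
  second (inj₁ (inj₁ (h , _) , _))          = posBar≮pos i k≤n h
  second (inj₁ (inj₂ _ , inj₁ (_ , h)))     = posBar≮pos k j≤n h
  second (inj₁ (inj₂ _ , inj₂ (h , _)))     = <⇒≱ (posBar-cancel-< n h) k≤i
  second (inj₂ (inj₁ (_ , h) , _))          = posBar≮pos k j≤n h
  second (inj₂ (inj₂ _ , inj₁ (_ , h)))     = <⇒≱ h j≤k
  second (inj₂ (inj₂ _ , inj₂ (h , _)))     = posBar≮pos i k≤n h
  noCross : ¬ Cross (mixed {n} (suc i) (suc j) p₁ p₂ p₃) (diam (suc k) q₁ q₂)
  noCross (here (here sc))         = first (SegCross⇒Separates _ _ sc)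
  noCross (there (here (here sc))) = second (SegCross⇒Separates _ _ sc)
  noCross (here (there ()))
  noCross (there (here (there ())))
  noCross (there (there ()))

¬Cross-diam-self : ∀ {n} k {q₁ q₂} → ¬ Cross {n} (diam (suc k) q₁ q₂) (diam (suc k) q₁ q₂)
¬Cross-diam-self {n} k (here (here sc)) = noCross (SegCross⇒Separates _ _ sc)
  where
  noCross : ¬ Separates (seg k (n + suc k)) (seg k (n + suc k))
  noCross (inj₁ (inj₁ (h , _) , _)) = <-irrefl refl h
  noCross (inj₁ (inj₂ (_ , h) , _)) = <-irrefl refl h
  noCross (inj₂ (inj₁ (_ , h) , _)) = <-irrefl refl h
  noCross (inj₂ (inj₂ (h , _) , _)) = <-irrefl refl h
¬Cross-diam-self k (here (there ()))
¬Cross-diam-self k (there ())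

Cross-diam-diam : ∀ {n} i k {p₁ p₂ q₁ q₂} → i ≤ n → k ≤ n → i ≢ k → Cross {n} (diam (suc i) p₁ p₂) (diam (suc k) q₁ q₂)
Cross-diam-diam {n} i k i≤n k≤n i≢k with <-cmp i k
... | tri< i<k _ _ = here (here (inj₁ (inj₁ (i<k , pos<posBar i k≤n , posBar-mono-< n i<k))))
... | tri≈ _ i≡k _ = ⊥-elim (i≢k i≡k)
... | tri> _ _ k<i = here (here (inj₁ (inj₂ (k<i , pos<posBar k i≤n , posBar-mono-< n k<i))))

Cross-same-diam : ∀ {n} i j {p₁ p₂ p₃} k {q₁ q₂} → j ≤ n → i < k → k < j →
  Cross (same {n} (suc i) (suc j) p₁ p₂ p₃) (diam (suc k) q₁ q₂)
Cross-same-diam i j k j≤n i<k k<j = here (here (inj₁ (inj₁ (i<k , k<j , pos<posBar k j≤n))))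

Cross-mixed-diam-right : ∀ {n} i j {p₁ p₂ p₃} k {q₁ q₂} → k ≤ n → j < i → i < k →
  Cross (mixed {n} (suc i) (suc j) p₁ p₂ p₃) (diam (suc k) q₁ q₂)
Cross-mixed-diam-right {n} i j k k≤n j<i i<k =
  here (here (inj₁ (inj₁ (i<k , pos<posBar j k≤n , posBar-mono-< n (<-trans j<i i<k)))))

Cross-mixed-diam-left : ∀ {n} i j {p₁ p₂ p₃} k {q₁ q₂} → i ≤ n → j < i → k < j →
  Cross (mixed {n} (suc i) (suc j) p₁ p₂ p₃) (diam (suc k) q₁ q₂)
Cross-mixed-diam-left {n} i j k i≤n j<i k<j =
  here (here (inj₁ (inj₂ (<-trans k<j j<i , pos<posBar k i≤n , posBar-mono-< n k<j))))

Cross-same-mixed : ∀ {n} i j {p₁ p₂ p₃} I J {q₁ q₂ q₃} → j ≤ n → i < J → J < j →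
  Cross (same {n} (suc i) (suc j) p₁ p₂ p₃) (mixed (suc I) (suc J) q₁ q₂ q₃)
Cross-same-mixed i j I J j≤n i<J J<j = here (there (here (inj₂ (inj₂ (inj₁ (inj₁ (i<J , J<j , pos<posBar I j≤n)))))))

Cross-mixed-mixed : ∀ {n} i j {p₁ p₂ p₃} I J {q₁ q₂ q₃} → I ≤ n → j < i → i < J → J < I →
  Cross (mixed {n} (suc i) (suc j) p₁ p₂ p₃) (mixed (suc I) (suc J) q₁ q₂ q₃)
Cross-mixed-mixed {n} i j I J I≤n j<i i<J J<I =
  here (there (here (inj₂ (inj₂ (inj₁ (inj₁ (i<J , pos<posBar j (<⇒≤ (<-≤-trans J<I I≤n)) ,
                                                 posBar-mono-< n (<-trans j<i (<-trans i<J J<I)))))))))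

DiameterFree : ∀ {n} → BDiag n → Set
DiameterFree (diam _ _ _)      = ⊥
DiameterFree (same _ _ _ _ _)  = ⊤
DiameterFree (mixed _ _ _ _ _) = ⊤

diameter-or-diameterFree : ∀ {n} (F : List (BDiag n)) →
  (Σ ℕ λ k → (1 ≤ k × k ≤ suc n) × HasDiam F k) ⊎ (∀ {d} → d ∈ F → DiameterFree d)
diameter-or-diameterFree [] = inj₂ (λ ())
diameter-or-diameterFree (diam i 1≤i i≤n ∷ F) = inj₁ (i , (1≤i , i≤n) , here refl)
diameter-or-diameterFree (same i j _ _ _ ∷ F) with diameter-or-diameterFree F
... | inj₁ (k , bounds , hasDiam) = inj₁ (k , bounds , there hasDiam)
... | inj₂ free = inj₂ λ { (here refl) → tt ; (there d∈F) → free d∈F }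
diameter-or-diameterFree (mixed i j _ _ _ ∷ F) with diameter-or-diameterFree F
... | inj₁ (k , bounds , hasDiam) = inj₁ (k , bounds , there hasDiam)
... | inj₂ free = inj₂ λ { (here refl) → tt ; (there d∈F) → free d∈F }

HasDiam⇒diam∈ : ∀ {n} {F : List (BDiag n)} {k} → HasDiam F k → Σ (1 ≤ k) λ p → Σ (k ≤ suc n) λ q → diam k p q ∈ F
HasDiam⇒diam∈ (here {diam i p q} refl) = p , q , here refl
HasDiam⇒diam∈ (there hasDiam) with HasDiam⇒diam∈ hasDiam
... | p , q , d∈F = p , q , there d∈F

-- the largest j with {{i, j̄+1}, {ī, j+1}} ∈ F, or 0 if there is none
maxMixedEnd : ∀ {n} → List (BDiag n) → ℕ
maxMixedEnd [] = 0
maxMixedEnd (diam _ _ _ ∷ F)            = maxMixedEnd F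
maxMixedEnd (same _ _ _ _ _ ∷ F)        = maxMixedEnd F
maxMixedEnd (mixed _ zero _ _ _ ∷ F)    = maxMixedEnd F
maxMixedEnd (mixed _ (suc j) _ _ _ ∷ F) = j ⊔ maxMixedEnd F

maxMixedEnd-≥ : ∀ {n} {F : List (BDiag n)} {i j p₁ p₂ p₃} → mixed i j p₁ p₂ p₃ ∈ F → j ≤ suc (maxMixedEnd F)
maxMixedEnd-≥ {F = mixed _ zero _ _ _ ∷ F}    (here refl) = z≤n
maxMixedEnd-≥ {F = mixed _ (suc j) _ _ _ ∷ F} (here refl) = s≤s (m≤m⊔n j (maxMixedEnd F))
maxMixedEnd-≥ {F = diam _ _ _ ∷ F}            (there m∈F) = maxMixedEnd-≥ m∈F
maxMixedEnd-≥ {F = same _ _ _ _ _ ∷ F}        (there m∈F) = maxMixedEnd-≥ m∈F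
maxMixedEnd-≥ {F = mixed _ zero _ _ _ ∷ F}    (there m∈F) = maxMixedEnd-≥ m∈F
maxMixedEnd-≥ {F = mixed _ (suc j) _ _ _ ∷ F} (there m∈F) =
  ≤-trans (maxMixedEnd-≥ m∈F) (s≤s (m≤n⊔m j (maxMixedEnd F)))

data MixedEndingAt {n} (F : List (BDiag n)) (j : ℕ) : Set where
  mixedEndingAt : ∀ i p₁ p₂ p₃ → mixed i j p₁ p₂ p₃ ∈ F → MixedEndingAt F j

MixedEndingAt-∷ : ∀ {n} {F : List (BDiag n)} {d j} → MixedEndingAt F j → MixedEndingAt (d ∷ F) j
MixedEndingAt-∷ (mixedEndingAt i p₁ p₂ p₃ m∈F) = mixedEndingAt i p₁ p₂ p₃ (there m∈F)

maxMixedEnd-attained : ∀ {n} (F : List (BDiag n)) → maxMixedEnd F ≡ 0 ⊎ MixedEndingAt F (suc (maxMixedEnd F))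
maxMixedEnd-attained [] = inj₁ refl
maxMixedEnd-attained (diam _ _ _ ∷ F)         = map₂ MixedEndingAt-∷ (maxMixedEnd-attained F)
maxMixedEnd-attained (same _ _ _ _ _ ∷ F)     = map₂ MixedEndingAt-∷ (maxMixedEnd-attained F)
maxMixedEnd-attained (mixed _ zero _ _ _ ∷ F) = map₂ MixedEndingAt-∷ (maxMixedEnd-attained F)
maxMixedEnd-attained (mixed i (suc j) p₁ p₂ p₃ ∷ F) with ⊔-sel j (maxMixedEnd F)
... | inj₁ j⊔≡j = inj₂ (subst (λ k → MixedEndingAt _ (suc k)) (sym j⊔≡j) (mixedEndingAt i p₁ p₂ p₃ (here refl)))
... | inj₂ j⊔≡m = map⊎ (trans j⊔≡m) (λ m → subst (λ k → MixedEndingAt _ (suc k)) (sym j⊔≡m) (MixedEndingAt-∷ m))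
                    (maxMixedEnd-attained F)

diam-at-maxMixedEnd-¬Cross : ∀ {n} {F : List (BDiag n)} → IsFace F → (∀ {d} → d ∈ F → DiameterFree d) →
  ∀ k {q₁ q₂} → (∀ {i j p₁ p₂ p₃} → mixed i j p₁ p₂ p₃ ∈ F → j ≤ suc k) → k ≡ 0 ⊎ MixedEndingAt F (suc k) →
  ∀ {d} → d ∈ F → ¬ Cross d (diam (suc k) q₁ q₂)
diam-at-maxMixedEnd-¬Cross face free k ≤k attained {diam _ _ _} d∈F = ⊥-elim (free d∈F)
diam-at-maxMixedEnd-¬Cross face free k ≤k attained {same zero j () _ _} d∈F
diam-at-maxMixedEnd-¬Cross face free k ≤k attained {same (suc i) zero _ () _} d∈F
diam-at-maxMixedEnd-¬Cross face free k ≤k attained {same (suc i) (suc zero) _ (s≤s ()) _} d∈F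
diam-at-maxMixedEnd-¬Cross {F = F} face free k {q₁} {q₂} ≤k attained
                           {same (suc i) (suc j) p₁ (s≤s 1+i<j) (s≤s j≤n)} d∈F =
  ¬Cross-same-diam i j {p₁} {s≤s 1+i<j} {s≤s j≤n} k {q₁} {q₂} 1+i<j j≤n (≤-pred q₂) (outside attained)
  where
  outside : k ≡ 0 ⊎ MixedEndingAt F (suc k) → k ≤ i ⊎ j ≤ k
  outside (inj₁ refl) = inj₁ z≤n
  outside (inj₂ (mixedEndingAt zero _ () _ _))
  outside (inj₂ (mixedEndingAt (suc I) r₁ (s≤s k<I) (s≤s I≤n) m∈F)) with k ≤? i | j ≤? k
  ... | yes k≤i | _       = inj₁ k≤i
  ... | no _    | yes j≤k = inj₂ j≤k
  ... | no k≰i  | no j≰k  = ⊥-elim (face d∈F m∈F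
    (Cross-same-mixed i j {p₁} {s≤s 1+i<j} {s≤s j≤n} I k {r₁} {s≤s k<I} {s≤s I≤n} j≤n (≰⇒> k≰i) (≰⇒> j≰k)))
diam-at-maxMixedEnd-¬Cross face free k ≤k attained {mixed i zero () _ _} d∈F
diam-at-maxMixedEnd-¬Cross face free k ≤k attained {mixed zero (suc j) _ () _} d∈F
diam-at-maxMixedEnd-¬Cross {F = F} face free k {q₁} {q₂} ≤k attained
                           {mixed (suc i) (suc j) p₁ (s≤s j<i) (s≤s i≤n)} d∈F =
  ¬Cross-mixed-diam i j {p₁} {s≤s j<i} {s≤s i≤n} k {q₁} {q₂} j<i i≤n (≤-pred q₂) (≤-pred (≤k d∈F)) (k≤i attained)
  where
  k≤i : k ≡ 0 ⊎ MixedEndingAt F (suc k) → k ≤ i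
  k≤i (inj₁ refl) = z≤n
  k≤i (inj₂ (mixedEndingAt zero _ () _ _))
  k≤i (inj₂ (mixedEndingAt (suc I) r₁ (s≤s k<I) (s≤s I≤n) m∈F)) with k ≤? i
  ... | yes k≤i = k≤i
  ... | no k≰i  = ⊥-elim (face d∈F m∈F
    (Cross-mixed-mixed i j {p₁} {s≤s j<i} {s≤s i≤n} I k {r₁} {s≤s k<I} {s≤s I≤n} I≤n j<i (≰⇒> k≰i) k<I))

facet-has-diameter : ∀ {n} (F : List (BDiag n)) → IsFacet F → Σ ℕ λ k → (1 ≤ k × k ≤ suc n) × HasDiam F k
facet-has-diameter {n} F (face , maximal) with diameter-or-diameterFree F
... | inj₁ diameter = diameter
... | inj₂ free     = ⊥-elim (maximal D (λ D∈F → free D∈F) D∷F-face)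
  where
  k = maxMixedEnd F
  k≤n : k ≤ n
  k≤n with maxMixedEnd-attained F
  ... | inj₁ k≡0 = subst (_≤ n) (sym k≡0) z≤n
  ... | inj₂ (mixedEndingAt I _ k<I I≤n _) = ≤-pred (<⇒≤ (<-≤-trans k<I I≤n))
  D : BDiag n
  D = diam (suc k) (s≤s z≤n) (s≤s k≤n)
  ¬Cross-D : ∀ {d} → d ∈ F → ¬ Cross d D
  ¬Cross-D = diam-at-maxMixedEnd-¬Cross face free k {s≤s z≤n} {s≤s k≤n} maxMixedEnd-≥ (maxMixedEnd-attained F)
  D∷F-face : IsFace (D ∷ F)
  D∷F-face (here refl) (here refl)   = ¬Cross-diam-self k {s≤s z≤n} {s≤s k≤n}
  D∷F-face (here refl) (there y∈F) c = ¬Cross-D y∈F (Cross-sym D _ c)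
  D∷F-face (there x∈F) (here refl)   = ¬Cross-D x∈F
  D∷F-face (there x∈F) (there y∈F)   = face x∈F y∈F

face-diameter-unique : ∀ {n} {F : List (BDiag n)} → IsFace F → ∀ {k k′} → HasDiam F k → HasDiam F k′ → k ≡ k′
face-diameter-unique face hasK hasK′ with HasDiam⇒diam∈ hasK | HasDiam⇒diam∈ hasK′
... | _ , _ , D∈F | _ , _ , D′∈F = unique D∈F D′∈F
  where
  unique : ∀ {a b p q p′ q′} → diam a p q ∈ _ → diam b p′ q′ ∈ _ → a ≡ b
  unique {suc a} {suc b} {s≤s z≤n} {s≤s a≤n} {s≤s z≤n} {s≤s b≤n} D∈F D′∈F with a ≟ b
  ... | yes a≡b = cong suc a≡b
  ... | no a≢b  = ⊥-elim (face D∈F D′∈F (Cross-diam-diam a b {s≤s z≤n} {s≤s a≤n} {s≤s z≤n} {s≤s b≤n} a≤n b≤n a≢b))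

PplusGen-resp : ∀ {n} {x y : Vec n} → x ≗ᵥ y → PplusGen y → PplusGen x
PplusGen-resp x≗y (inj₁ y≗0) = inj₁ (λ t → trans (x≗y t) (y≗0 t))
PplusGen-resp x≗y (inj₂ (i , j , 1≤i , i<j , j≤n , y≗)) = inj₂ (i , j , 1≤i , i<j , j≤n , λ t → trans (x≗y t) (y≗ t))

Conv-precompose : ∀ {n} {S T : Vec n → Set} (f : Fin (suc n) → Fin (suc n)) →
  (∀ {p} → S p → T (λ t → p (f t))) → ∀ {y} → Conv S y → Conv T (λ t → y (f t))
Conv-precompose {n} {S} {T} f S⇒T (ps , inS , ws , len , nonneg , total , y≡) =
  map _∘f ps , AllP.map⁺ (All.map S⇒T inS) , ws , trans len (sym (length-map _∘f ps)) , nonneg , total ,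
  λ s → trans (y≡ (f s)) (cong sumℚ (zipWith-∘f ws ps s))
  where
  _∘f : Vec n → Vec n
  _∘f p t = p (f t)
  zipWith-∘f : ∀ (ws : List ℚ) ps s →
    zipWith (λ w p → w *ℚ p (f s)) ws ps ≡ zipWith (λ w p → w *ℚ p s) ws (map _∘f ps)
  zipWith-∘f []       ps       s = refl
  zipWith-∘f (w ∷ ws) []       s = refl
  zipWith-∘f (w ∷ ws) (p ∷ ps) s = cong (_ ∷_) (zipWith-∘f ws ps s)

same-arrow∘sucC^-PplusGen : ∀ {n i j} k → suc i < j → j ≤ n → k ≤ n → k ≤ i ⊎ j ≤ k →
  PplusGen {n} (λ s → arrowVec j (suc i) (sucC^ k s))
same-arrow∘sucC^-PplusGen {n} {i} {j} k 1+i<j j≤n k≤n k∉⟨i,j⟩ =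
  arrow∘sucC^-PplusGen k j (suc i) k≤n (≤-trans (s≤s z≤n) 1+i<j) (m≤n⇒m≤1+n j≤n) (s≤s z≤n)
    (≤-trans (<⇒≤ 1+i<j) (m≤n⇒m≤1+n j≤n)) (inj₂ (before k∉⟨i,j⟩))
  where
  before : k ≤ i ⊎ j ≤ k → CyclicallyBefore k (suc i) j
  before (inj₁ k≤i) = inj₁ (s≤s k≤i , ≤-<-trans k≤i (<-trans (n<1+n i) 1+i<j) , 1+i<j)
  before (inj₂ j≤k) = inj₂ (inj₂ (≤-trans (<⇒≤ 1+i<j) j≤k , j≤k , 1+i<j))

mixed-arrow∘sucC^-PplusGen : ∀ {n i j p₁ p₂ p₃} k → j < i → i ≤ n → k ≤ n → j ≤ k → k ≤ i →
  PplusGen (λ s → arrowVecOf (mixed {n} (suc i) (suc j) p₁ p₂ p₃) (sucC^ k s))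
mixed-arrow∘sucC^-PplusGen {n} {i} {zero} k _ i≤n k≤n _ k≤i with i ≟ n
... | yes refl = arrow∘sucC^-PplusGen k (suc n) (suc n) k≤n (s≤s z≤n) ≤-refl (s≤s z≤n) ≤-refl (inj₁ refl)
... | no i≢n   = arrow∘sucC^-PplusGen k (suc n) (suc i) k≤n (s≤s z≤n) ≤-refl (s≤s z≤n) (s≤s i≤n)
                   (inj₂ (inj₁ (s≤s k≤i , s≤s k≤n , s≤s (≤∧≢⇒< i≤n i≢n))))
mixed-arrow∘sucC^-PplusGen {n} {i} {suc j} k j<i i≤n k≤n j<k k≤i =
  arrow∘sucC^-PplusGen k (suc j) (suc i) k≤n (s≤s z≤n) (m≤n⇒m≤1+n (≤-trans (<⇒≤ j<i) i≤n)) (s≤s z≤n) (s≤s i≤n)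
    (inj₂ (inj₂ (inj₁ (s≤s k≤i , j<k))))

¬Cross-diam⇒arrow∘sucC^-PplusGen : ∀ {n} → 1 ≤ n → ∀ k {q₁ : 1 ≤ suc k} {q₂ : suc k ≤ suc n} (d : BDiag n) →
  ¬ Cross d (diam (suc k) q₁ q₂) → PplusGen (λ s → arrowVecOf d (sucC^ k s))
¬Cross-diam⇒arrow∘sucC^-PplusGen _ k (diam zero () _) _
¬Cross-diam⇒arrow∘sucC^-PplusGen _ k {q₁} {q₂} (diam (suc i) p₁ p₂) ¬cross with i ≟ k
... | no i≢k = ⊥-elim (¬cross (Cross-diam-diam i k {p₁} {p₂} {q₁} {q₂} (≤-pred p₂) (≤-pred q₂) i≢k))
¬Cross-diam⇒arrow∘sucC^-PplusGen {n} 1≤n zero (diam (suc .zero) _ _) _ | yes refl =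
  arrow∘sucC^-PplusGen 0 (suc n) 1 z≤n (s≤s z≤n) ≤-refl (s≤s z≤n) (s≤s z≤n) (inj₂ (inj₁ (s≤s z≤n , s≤s z≤n , s≤s 1≤n)))
¬Cross-diam⇒arrow∘sucC^-PplusGen _ (suc k) {q₂ = k+2≤n+1} (diam (suc .(suc k)) _ _) _ | yes refl =
  arrow∘sucC^-PplusGen (suc k) (suc k) (suc (suc k)) (≤-pred k+2≤n+1) (s≤s z≤n) (<⇒≤ k+2≤n+1) (s≤s z≤n) k+2≤n+1
    (inj₂ (inj₂ (inj₁ (≤-refl , ≤-refl))))
¬Cross-diam⇒arrow∘sucC^-PplusGen _ k (same zero j () _ _) _
¬Cross-diam⇒arrow∘sucC^-PplusGen _ k (same (suc i) zero _ () _) _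
¬Cross-diam⇒arrow∘sucC^-PplusGen _ k (same (suc i) (suc zero) _ (s≤s ()) _) _
¬Cross-diam⇒arrow∘sucC^-PplusGen _ k {q₁} {q₂} (same (suc i) (suc j) p₁ (s≤s 1+i<j) (s≤s j≤n)) ¬cross
  with k ≤? i | j ≤? k
... | yes k≤i | _       = same-arrow∘sucC^-PplusGen k 1+i<j j≤n (≤-pred q₂) (inj₁ k≤i)
... | no _    | yes j≤k = same-arrow∘sucC^-PplusGen k 1+i<j j≤n (≤-pred q₂) (inj₂ j≤k)
... | no k≰i | no j≰k =
  ⊥-elim (¬cross (Cross-same-diam i j {p₁} {s≤s 1+i<j} {s≤s j≤n} k {q₁} {q₂} j≤n (≰⇒> k≰i) (≰⇒> j≰k)))
¬Cross-diam⇒arrow∘sucC^-PplusGen _ k (mixed i zero () _ _) _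
¬Cross-diam⇒arrow∘sucC^-PplusGen _ k (mixed zero (suc j) _ () _) _
¬Cross-diam⇒arrow∘sucC^-PplusGen _ k {q₁} {q₂} (mixed (suc i) (suc j) p₁ (s≤s j<i) (s≤s i≤n)) ¬cross
  with j ≤? k | k ≤? i
... | no j≰k | _ =
  ⊥-elim (¬cross (Cross-mixed-diam-left i j {p₁} {s≤s j<i} {s≤s i≤n} k {q₁} {q₂} i≤n j<i (≰⇒> j≰k)))
... | yes _ | no k≰i =
  ⊥-elim (¬cross (Cross-mixed-diam-right i j {p₁} {s≤s j<i} {s≤s i≤n} k {q₁} {q₂} (≤-pred q₂) j<i (≰⇒> k≰i)))
¬Cross-diam⇒arrow∘sucC^-PplusGen _ k {q₂ = q₂} (mixed (suc i) (suc j) _ (s≤s j<i) (s≤s i≤n)) _ | yes j≤k | yes k≤i =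
  mixed-arrow∘sucC^-PplusGen k j<i i≤n (≤-pred q₂) j≤k k≤i

HasDiam⇒ArrowSimplex⊆ZetaPplus : ∀ {n} → 1 ≤ n → {F : List (BDiag n)} → IsFace F → ∀ {k} →
  HasDiam F (suc k) → ArrowSimplex F ⊆ᵥ ZetaPplus k
HasDiam⇒ArrowSimplex⊆ZetaPplus 1≤n face {k} hasDiam y y∈simplex with HasDiam⇒diam∈ hasDiam
... | q₁ , q₂ , D∈F = ZetaPplus-intro k y (Conv-precompose (sucC^ k) rotatedArrow y∈simplex)
  where
  rotatedArrow : ∀ {p} → ∃[ d ] (d ∈ _ × p ≗ᵥ arrowVecOf d) → PplusGen (λ t → p (sucC^ k t))
  rotatedArrow (d , d∈F , p≗) =
    PplusGen-resp (λ t → p≗ (sucC^ k t)) (¬Cross-diam⇒arrow∘sucC^-PplusGen 1≤n k {q₁} {q₂} d (face d∈F D∈F))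

prefixSum-basis-step : ∀ {m} c → 1 ≤ c → c ≤ m → prefixSum {m} c (λ s → basis (suc c) s -ℚ basis c s) ≡ 0ℚ -ℚ 1ℚ
prefixSum-basis-step {m} c 1≤c c≤m = begin
  prefixSum c (λ s → basis (suc c) s -ℚ basis c s)      ≡⟨ prefixSum-sub c (basis (suc c)) (basis c) ⟩
  prefixSum c (basis (suc c)) -ℚ prefixSum c (basis c) ≡⟨ cong₂ _-ℚ_ (prefixSum-basis-out c (suc c) ≤-refl)
                                                                    (prefixSum-basis-in c c 1≤c ≤-refl c≤m) ⟩
  0ℚ -ℚ 1ℚ                                               ∎
  where open ≡-Reasoning

-- the first c coordinates of e_{c+1} − e_c sum to −1
arrow-step∉Pplus : ∀ {n} c → 1 ≤ c → c ≤ suc n → ¬ Pplus {n} (arrowVec c (suc c))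
arrow-step∉Pplus c 1≤c c≤n step∈P⁺ =
  toWitnessFalse {a? = 0ℚ ℚ.≤? (0ℚ -ℚ 1ℚ)} tt
    (subst (0ℚ ≤ℚ_) (prefixSum-basis-step c 1≤c c≤n) (Pplus-prefixSum-nonneg c step∈P⁺))

cycPred^-cycPred : ∀ {n} m b → m ≤ n → 1 ≤ b → b ≤ suc n → b ≢ suc m →
  cycPred^ n m b ≡ suc (cycPred^ n m (cycPred n b))
cycPred^-cycPred {n} zero    (suc zero) _ _ _ 1≢1 = ⊥-elim (1≢1 refl)
cycPred^-cycPred {n} (suc m) (suc zero) m<n _ _ _ =
  +-cancelʳ-≡ (suc m) _ _ (trans (CycShift-wrap sb (s≤s z≤n)) (cong suc (sym (CycShift-noWrap sa (s≤s m<n)))))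
  where
  sb = cycPred^-shift n (suc m) 1 m<n (s≤s z≤n) (s≤s z≤n)
  sa = cycPred^-shift n (suc m) (suc n) m<n (s≤s z≤n) ≤-refl
cycPred^-cycPred {n} m (suc (suc c)) m≤n _ c+2≤n+1 c+2≢m+1 with <-cmp m (suc c)
... | tri< m<c+1 _ _ =
  +-cancelʳ-≡ m _ _ (trans (CycShift-noWrap sb (<-trans m<c+1 (n<1+n (suc c)))) (cong suc (sym (CycShift-noWrap sa m<c+1))))
  where
  sb = cycPred^-shift n m (suc (suc c)) m≤n (s≤s z≤n) c+2≤n+1
  sa = cycPred^-shift n m (suc c) m≤n (s≤s z≤n) (<⇒≤ c+2≤n+1)
... | tri≈ _ m≡c+1 _ = ⊥-elim (c+2≢m+1 (cong suc (sym m≡c+1)))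
... | tri> _ _ c+1<m =
  +-cancelʳ-≡ m _ _ (trans (CycShift-wrap sb c+1<m) (cong suc (sym (CycShift-wrap sa (<⇒≤ c+1<m)))))
  where
  sb = cycPred^-shift n m (suc (suc c)) m≤n (s≤s z≤n) c+2≤n+1
  sa = cycPred^-shift n m (suc c) m≤n (s≤s z≤n) (<⇒≤ c+2≤n+1)

arrowVecOf-diam : ∀ {n} b {p q} → arrowVecOf (diam {n} b p q) ≗ᵥ arrowVec (cycPred n b) b
arrowVecOf-diam (suc zero)    t = refl
arrowVecOf-diam (suc (suc c)) t = refl

diam-arrow∉ZetaPplus : ∀ {n} k → k ≤ n → ∀ b {p q} → b ≢ suc k → ¬ ZetaPplus k (arrowVecOf (diam {n} b p q))
diam-arrow∉ZetaPplus {n} k k≤n b {1≤b} {b≤n} b≢k+1 arrow∈ζ^P⁺ =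
  arrow-step∉Pplus c 1≤c c≤n (Conv-resp rotatedArrow≗step (ZetaPplus-elim k _ arrow∈ζ^P⁺))
  where
  a = cycPred n b
  1≤a = proj₁ (cycPred-bounded n b 1≤b b≤n)
  a≤n = proj₂ (cycPred-bounded n b 1≤b b≤n)
  c = cycPred^ n k a
  1≤c = proj₁ (cycPred^-bounded k a k≤n 1≤a a≤n)
  c≤n = proj₂ (cycPred^-bounded k a k≤n 1≤a a≤n)
  rotatedArrow≗step : (λ s → arrowVecOf (diam {n} b 1≤b b≤n) (sucC^ k s)) ≗ᵥ arrowVec c (suc c)
  rotatedArrow≗step s = begin
    arrowVecOf (diam b 1≤b b≤n) (sucC^ k s)       ≡⟨ arrowVecOf-diam b (sucC^ k s) ⟩
    basis b (sucC^ k s) -ℚ basis a (sucC^ k s)    ≡⟨ cong₂ _-ℚ_ (basis-sucC^ k b 1≤b b≤n s) (basis-sucC^ k a 1≤a a≤n s) ⟩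
    basis (cycPred^ n k b) s -ℚ basis c s         ≡⟨ cong (λ r → basis r s -ℚ basis c s) (cycPred^-cycPred k b k≤n 1≤b b≤n b≢k+1) ⟩
    basis (suc c) s -ℚ basis c s                  ∎
    where open ≡-Reasoning

arrowVecOf∈ArrowSimplex : ∀ {n} {F : List (BDiag n)} {d} → d ∈ F → ArrowSimplex F (arrowVecOf d)
arrowVecOf∈ArrowSimplex {d = d} d∈F =
  arrowVecOf d ∷ [] , (d , d∈F , λ _ → refl) ∷ [] ,
  1ℚ ∷ [] , refl , toWitness {a? = 0ℚ ℚ.≤? 1ℚ} tt ∷ [] , ℚP.+-identityʳ 1ℚ ,
  λ t → sym (trans (ℚP.+-identityʳ _) (ℚP.*-identityˡ _))

ArrowSimplex⊆ZetaPplus⇒HasDiam : ∀ {n} {F : List (BDiag n)} {b k} → HasDiam F b → k ≤ n →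
  ArrowSimplex F ⊆ᵥ ZetaPplus k → HasDiam F (suc k)
ArrowSimplex⊆ZetaPplus⇒HasDiam {b = b} {k} hasB k≤n simplex⊆ with b ≟ suc k | HasDiam⇒diam∈ hasB
... | yes b≡k+1 | _ = subst (HasDiam _) b≡k+1 hasB
... | no b≢k+1  | _ , _ , B∈F =
  ⊥-elim (diam-arrow∉ZetaPplus k k≤n b b≢k+1 (simplex⊆ _ (arrowVecOf∈ArrowSimplex B∈F)))

theorem7p2 : (n : ℕ) → 1 ≤ n → (F : List (BDiag n)) → IsFacet F →
    (Σ ℕ (λ k → (1 ≤ k × k ≤ suc n) × HasDiam F k × ((k′ : ℕ) → HasDiam F k′ → k′ ≡ k)))
    × ((k : ℕ) → 1 ≤ k → k ≤ suc n →
        ((ArrowSimplex F ⊆ᵥ ZetaPplus (k ∸ 1)) → HasDiam F k)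
        × (HasDiam F k → (ArrowSimplex F ⊆ᵥ ZetaPplus (k ∸ 1))))
theorem7p2 n 1≤n F facet@(face , _) with facet-has-diameter F facet
... | k₀ , bounds , hasK₀ =
  (k₀ , bounds , hasK₀ , λ _ hasK′ → face-diameter-unique face hasK′ hasK₀) ,
  λ { (suc k) _ k+1≤n+1 →
        ArrowSimplex⊆ZetaPplus⇒HasDiam hasK₀ (≤-pred k+1≤n+1) , HasDiam⇒ArrowSimplex⊆ZetaPplus 1≤n face }
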